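{- For arbitrary graphs $G_1$ and $G_2$ on disjoint vertex sets, \[\varsigma_c(G_1\cup G_2)=\begin{cases}\infty, & \text{if $G_1$ or $G_2$ has two non-clique components, or both $G_1,G_2$ are not $P_3$-free;}\\ \varsigma_c(C), & \text{if one of $G_1,G_2$ is $P_3$-free and $C$ is the unique non-clique component of the other;}\\ 0, & \text{if $G_1$ and $G_2$ are $P_3$-free.}\end{cases}\]
   Context: Graphs are finite, simple, undirected. $G_1\cup G_2$ is the disjoint union. A non-clique component is a connected component that is not a clique. A set $S\subseteq V(G)$ is a connected cluster vertex deletion set of $G$ if every connected component of $G-S$ is a clique and $G[S]$ is connected. $\varsigma_c(G)$ is the minimum size of such a set, and $\varsigma_c(G)=\infty$ if none exists. -}

module Defs where

open import Data.Bool using (Bool; true; false)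
open import Data.Nat using (ℕ; _≤_)
open import Data.Fin using (Fin; splitAt)
open import Data.Fin.Subset using (Subset; _∈_; _∉_; _⊆_; _─_; ∣_∣) renaming (⊤ to Full)
open import Data.Sum using (_⊎_; inj₁; inj₂)
open import Data.Product using (Σ; ∃; _×_; _,_)
open import Relation.Binary.PropositionalEquality using (_≡_; _≢_; refl)
open import Relation.Nullary using (¬_)

record Graph (n : ℕ) : Set where
  field
    adj   : Fin n → Fin n → Bool
    adj-sym : ∀ u v → adj u v ≡ adj v u
    irref : ∀ v → adj v v ≡ false
open Graph public

-- Disjoint union G₁ ∪ G₂ on Fin (n₁ + n₂): the first n₁ vertices are G₁, the rest G₂.
uadj : ∀ {a b} → (Fin a → Fin a → Bool) → (Fin b → Fin b → Bool)
     → Fin a ⊎ Fin b → Fin a ⊎ Fin b → Bool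
uadj f g (inj₁ x) (inj₁ y) = f x y
uadj f g (inj₂ x) (inj₂ y) = g x y
uadj f g (inj₁ x) (inj₂ y) = false
uadj f g (inj₂ x) (inj₁ y) = false

uadj-sym : ∀ {a b} (G₁ : Graph a) (G₂ : Graph b) x y
         → uadj (adj G₁) (adj G₂) x y ≡ uadj (adj G₁) (adj G₂) y x
uadj-sym G₁ G₂ (inj₁ x) (inj₁ y) = adj-sym G₁ x y
uadj-sym G₁ G₂ (inj₂ x) (inj₂ y) = adj-sym G₂ x y
uadj-sym G₁ G₂ (inj₁ x) (inj₂ y) = refl
uadj-sym G₁ G₂ (inj₂ x) (inj₁ y) = refl

uadj-irr : ∀ {a b} (G₁ : Graph a) (G₂ : Graph b) x → uadj (adj G₁) (adj G₂) x x ≡ false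
uadj-irr G₁ G₂ (inj₁ x) = irref G₁ x
uadj-irr G₁ G₂ (inj₂ x) = irref G₂ x

_⊕_ : ∀ {n₁ n₂} → Graph n₁ → Graph n₂ → Graph (n₁ Data.Nat.+ n₂)
_⊕_ {n₁} G₁ G₂ = record
  { adj   = λ u v → uadj (adj G₁) (adj G₂) (splitAt n₁ u) (splitAt n₁ v)
  ; adj-sym = λ u v → uadj-sym G₁ G₂ (splitAt n₁ u) (splitAt n₁ v)
  ; irref = λ v → uadj-irr G₁ G₂ (splitAt n₁ v)
  }

data Reach {n} (G : Graph n) (U : Subset n) : Fin n → Fin n → Set where
  here : ∀ {u} → u ∈ U → Reach G U u u
  step : ∀ {u w v} → u ∈ U → adj G u w ≡ true → Reach G U w v → Reach G U u v

-- G[U][S] is connected (the empty graph counts as connected).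
ConnectedIn : ∀ {n} → Graph n → Subset n → Set
ConnectedIn G S = ∀ u v → u ∈ S → v ∈ S → Reach G S u v

IsComponentIn : ∀ {n} → Graph n → Subset n → Subset n → Set
IsComponentIn G U C =
  C ⊆ U × (∃ λ v → v ∈ C) × ConnectedIn G C
  × (∀ u v → u ∈ C → Reach G U u v → v ∈ C)

IsComponent : ∀ {n} → Graph n → Subset n → Set
IsComponent G C = IsComponentIn G Full C

IsClique : ∀ {n} → Graph n → Subset n → Set
IsClique G C = ∀ u v → u ∈ C → v ∈ C → u ≢ v → adj G u v ≡ true

NonCliqueComponent : ∀ {n} → Graph n → Subset n → Set
NonCliqueComponent G C = IsComponent G C × ¬ IsClique G C

HasTwoNonCliqueComponents : ∀ {n} → Graph n → Set
HasTwoNonCliqueComponents G =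
  ∃ λ C → ∃ λ D → NonCliqueComponent G C × NonCliqueComponent G D × C ≢ D

P3Free : ∀ {n} → Graph n → Set
P3Free G = ∀ a b c → adj G a b ≡ true → adj G b c ≡ true → a ≢ c → adj G a c ≡ true

IsCCVDIn : ∀ {n} → Graph n → Subset n → Subset n → Set
IsCCVDIn G U S =
  S ⊆ U × (∀ C → IsComponentIn G (U ─ S) C → IsClique G C) × ConnectedIn G S

data ℕ∞ : Set where
  fin : ℕ → ℕ∞
  ∞   : ℕ∞

ςcIn≡ : ∀ {n} → Graph n → Subset n → ℕ∞ → Set
ςcIn≡ G U (fin k) =
  (∃ λ S → IsCCVDIn G U S × ∣ S ∣ ≡ k) × (∀ S → IsCCVDIn G U S → k ≤ ∣ S ∣)
ςcIn≡ G U ∞ = ∀ S → ¬ IsCCVDIn G U S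

ςc≡ : ∀ {n} → Graph n → ℕ∞ → Set
ςc≡ G = ςcIn≡ G Full

{-# OPTIONS --safe #-}
-- The components of a graph are all cliques iff it has no induced P₃, so T is a connected
-- cluster vertex deletion set of H = G₁ ∪ G₂ iff T is connected and H − T is P₃-free.
-- A connected T stays inside one summand, and it must meet every non-clique component C
-- (otherwise C survives in H − T), hence lie inside C. So two non-clique components in one
-- summand, or induced P₃s in both summands, leave no solution. If C is the only non-clique
-- component of G₁ and G₂ is P₃-free, restricting a solution of H to G₁ and including a
-- solution of G₁[C] into H are size-preserving maps between the two solution sets, so the
-- minima agree; if both summands are P₃-free, ∅ is a solution.
module Submission where

open import Data.Bool using (Bool; true; false) renaming (_≟_ to _≟ᵇ_)
open import Data.Empty using (⊥-elim)
open import Data.Fin using (Fin; _↑ˡ_; _↑ʳ_; join; _≟_)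
open import Data.Fin.Properties using (any?; +↔⊎; splitAt-join)
open import Data.Fin.Subset
  using (Subset; _∈_; _∉_; _⊆_; _─_; _-_; _∩_; ∁; ∣_∣; ⁅_⁆; inside; outside)
  renaming (⊤ to Full; ⊥ to ∅)
open import Data.Fin.Subset.Properties
  using ( _∈?_; ∈⊤; ∉⊥; ⊆-antisym; Empty-unique; ∣⊥∣≡0; ∣p∣≤n; p─q⊆p; p∩q⊆p
        ; x∈p∧x∉q⇒x∈p─q; x∈p∧x≢y⇒x∈p-y; x∈p⇒∣p-x∣<∣p∣; x∈⁅x⁆; x∈p∩q⁺; x∈p∩q⁻; x∈∁p⇒x∉p; x∉p⇒x∈∁p )
open import Data.Nat using (ℕ; suc; _+_; _≤_; _<_; z≤n; s≤s)
open import Data.Nat.Properties using (+-comm; +-identityʳ; <-≤-trans)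
open import Data.Product using (∃; _×_; _,_; proj₁)
open import Data.Sum using (_⊎_; inj₁; inj₂; [_,_]′) renaming (swap to ⊎-swap)
open import Data.Sum.Properties using (swap-↔; inj₁-injective)
open import Data.Vec using ([]; _∷_; _++_; lookup; tabulate; here; there)
import Data.Vec as Vec
open import Data.Vec.Properties
  using ([]=⇒lookup; lookup⇒[]=; lookup∘tabulate; tabulate∘lookup; tabulate-cong; lookup-++ˡ; lookup-++ʳ)
open import Function using (_∘_; const)
open import Function.Bundles using (_⇔_; mk⇔; _↔_; Inverse; Injection)
open import Function.Construct.Composition using (_↔-∘_)
open import Function.Construct.Symmetry using (↔-sym)
open import Function.Properties.Inverse using (↔⇒↣)
open import Relation.Binary.PropositionalEquality
  using (_≡_; _≢_; refl; sym; trans; cong; cong₂; subst; module ≡-Reasoning)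
open import Relation.Nullary using (¬_; Dec; yes; no; does; contradiction)
open import Relation.Nullary.Decidable using (_×-dec_; map′; dec-true)

open import Defs

private
  variable
    n m m′ N : ℕ

∈-tabulate⁺ : ∀ {f : Fin n → Bool} {x} → f x ≡ true → x ∈ tabulate f
∈-tabulate⁺ {f = f} {x} fx = lookup⇒[]= x (tabulate f) (trans (lookup∘tabulate f x) fx)

∈-tabulate⁻ : ∀ {f : Fin n → Bool} {x} → x ∈ tabulate f → f x ≡ true
∈-tabulate⁻ {f = f} {x} x∈ = trans (sym (lookup∘tabulate f x)) ([]=⇒lookup x∈)

x∈p─q⇒x∉q : ∀ {p q : Subset n} {x} → x ∈ p ─ q → x ∉ q
x∈p─q⇒x∉q {p = _ ∷ _} {outside ∷ _} here       ()
x∈p─q⇒x∉q {p = _ ∷ _} {_ ∷ _}       (there x∈) (there x∈q) = x∈p─q⇒x∉q x∈ x∈q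

∣∣-++ : ∀ (p : Subset n) (q : Subset m) → ∣ p ++ q ∣ ≡ ∣ p ∣ + ∣ q ∣
∣∣-++ []            q = refl
∣∣-++ (inside ∷ p)  q = cong suc (∣∣-++ p q)
∣∣-++ (outside ∷ p) q = ∣∣-++ p q

opaque
  preimage : (Fin m → Fin n) → Subset n → Subset m
  preimage f T = tabulate (lookup T ∘ f)

  ∈-preimage⁺ : ∀ {f : Fin m → Fin n} {T a} → f a ∈ T → a ∈ preimage f T
  ∈-preimage⁺ fa∈ = ∈-tabulate⁺ ([]=⇒lookup fa∈)

  ∈-preimage⁻ : ∀ {f : Fin m → Fin n} {T a} → a ∈ preimage f T → f a ∈ T
  ∈-preimage⁻ {f = f} {T} {a} a∈ = lookup⇒[]= (f a) T (∈-tabulate⁻ a∈)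

  preimage-↑ˡ : ∀ (p : Subset m) (q : Subset n) → preimage (_↑ˡ n) (p ++ q) ≡ p
  preimage-↑ˡ p q = trans (tabulate-cong (lookup-++ˡ p q)) (tabulate∘lookup p)

  preimage-↑ʳ : ∀ (p : Subset m) (q : Subset n) → preimage (m ↑ʳ_) (p ++ q) ≡ q
  preimage-↑ʳ p q = trans (tabulate-cong (lookup-++ʳ p q)) (tabulate∘lookup q)

module _ {G : Graph n} where

  source : ∀ {U u v} → Reach G U u v → u ∈ U
  source (here u∈)     = u∈
  source (step u∈ _ _) = u∈

  target : ∀ {U u v} → Reach G U u v → v ∈ U
  target (here v∈)    = v∈
  target (step _ _ r) = target r

  infixr 5 _◅◅_
  _◅◅_ : ∀ {U u v w} → Reach G U u v → Reach G U v w → Reach G U u w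
  here _      ◅◅ r′ = r′
  step u∈ e r ◅◅ r′ = step u∈ e (r ◅◅ r′)

  edge : ∀ {U u v} → u ∈ U → v ∈ U → adj G u v ≡ true → Reach G U u v
  edge u∈ v∈ e = step u∈ e (here v∈)

  reverse : ∀ {U u v} → Reach G U u v → Reach G U v u
  reverse (here u∈) = here u∈
  reverse {u = u} (step {w = w} u∈ e r) = reverse r ◅◅ edge (source r) u∈ (trans (adj-sym G w u) e)

  Reach-restrict : ∀ {U V u v} → (∀ {x} → Reach G U u x → x ∈ V) → Reach G U u v → Reach G V u v
  Reach-restrict inV (here u∈)     = here (inV (here u∈))
  Reach-restrict inV (step u∈ e r) = step (inV (here u∈)) e (Reach-restrict (inV ∘ step u∈ e) r)

  Reach-mono : ∀ {U V u v} → U ⊆ V → Reach G U u v → Reach G V u v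
  Reach-mono U⊆V = Reach-restrict (U⊆V ∘ target)

  Reach-closed : ∀ {U u v} (P : Fin n → Set) → (∀ {x y} → P x → adj G x y ≡ true → P y)
               → P u → Reach G U u v → P v
  Reach-closed P closed Pu (here _)     = Pu
  Reach-closed P closed Pu (step _ e r) = Reach-closed P closed (closed Pu e) r

  Reach-last-visit : ∀ {U x v} u → Reach G U x v
                   → Reach G (U - u) x v ⊎ u ≡ v ⊎ ∃ λ w → adj G u w ≡ true × Reach G (U - u) w v
  Reach-last-visit u (here {x} x∈) with x ≟ u
  ... | yes refl = inj₂ (inj₁ refl)
  ... | no x≢u   = inj₁ (here (x∈p∧x≢y⇒x∈p-y x∈ x≢u))
  Reach-last-visit u (step {x} {w} x∈ e r) with Reach-last-visit u r
  ... | inj₂ later = inj₂ later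
  ... | inj₁ r′ with x ≟ u
  ...   | yes refl = inj₂ (inj₂ (w , e , r′))
  ...   | no x≢u   = inj₁ (step (x∈p∧x≢y⇒x∈p-y x∈ x≢u) e r′)

  Reach-unfold : ∀ {U u v} → Reach G U u v → u ≢ v → ∃ λ w → adj G u w ≡ true × Reach G (U - u) w v
  Reach-unfold {u = u} r u≢v with Reach-last-visit u r
  ... | inj₁ r′               = contradiction (x∈⁅x⁆ u) (x∈p─q⇒x∉q (source r′))
  ... | inj₂ (inj₁ u≡v)       = contradiction u≡v u≢v
  ... | inj₂ (inj₂ continued) = continued

-- The fuel k bounds ∣ U ∣, which drops when the start vertex is removed.
Reach?′ : ∀ (G : Graph n) k U → ∣ U ∣ < k → ∀ u v → Dec (Reach G U u v)
Reach?′ G (suc k) U (s≤s ∣U∣≤k) u v with u ∈? U | u ≟ v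
... | no u∉U | _        = no (u∉U ∘ source)
... | yes u∈U | yes refl = yes (here u∈U)
... | yes u∈U | no u≢v   =
  map′ (λ (w , e , r) → step u∈U e (Reach-mono (p─q⊆p U ⁅ u ⁆) r)) (λ r → Reach-unfold r u≢v)
       (any? λ w → (adj G u w ≟ᵇ true) ×-dec Reach?′ G k (U - u) (<-≤-trans (x∈p⇒∣p-x∣<∣p∣ u∈U) ∣U∣≤k) w v)

Reach? : ∀ (G : Graph n) U u v → Dec (Reach G U u v)
Reach? {n} G U = Reach?′ G (suc n) U (s≤s (∣p∣≤n U))

component : Graph n → Subset n → Fin n → Subset n
component G U u = tabulate (does ∘ Reach? G U u)

module _ {G : Graph n} {U : Subset n} {u : Fin n} where

  ∈-component⁺ : ∀ {v} → Reach G U u v → v ∈ component G U u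
  ∈-component⁺ {v} r = ∈-tabulate⁺ (dec-true (Reach? G U u v) r)

  ∈-component⁻ : ∀ {v} → v ∈ component G U u → Reach G U u v
  ∈-component⁻ {v} v∈ with Reach? G U u v | ∈-tabulate⁻ {f = does ∘ Reach? G U u} v∈
  ... | yes r | _ = r

  component-isComponent : u ∈ U → IsComponentIn G U (component G U u)
  component-isComponent u∈ =
      target ∘ ∈-component⁻
    , (u , ∈-component⁺ (here u∈))
    , (λ a b a∈ b∈ → Reach-restrict (λ r → ∈-component⁺ (∈-component⁻ a∈ ◅◅ r))
                                    (reverse (∈-component⁻ a∈) ◅◅ ∈-component⁻ b∈))
    , λ a b a∈ r → ∈-component⁺ (∈-component⁻ a∈ ◅◅ r)

components-equal : ∀ {G : Graph n} {U C D a} → IsComponentIn G U C → IsComponentIn G U D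
                 → a ∈ C → a ∈ D → C ≡ D
components-equal {a = a} C-comp D-comp a∈C a∈D =
  ⊆-antisym (⊆-sharing C-comp D-comp a∈D a∈C) (⊆-sharing D-comp C-comp a∈C a∈D)
  where
  ⊆-sharing : ∀ {G : Graph _} {U C D} → IsComponentIn G U C → IsComponentIn G U D → a ∈ D → a ∈ C → C ⊆ D
  ⊆-sharing (C⊆U , _ , C-conn , _) (_ , _ , _ , D-closed) a∈D a∈C v∈C =
    D-closed a _ a∈D (Reach-mono C⊆U (C-conn a _ a∈C v∈C))

P3FreeAt : Graph n → Subset n → Fin n → Set
P3FreeAt G U b = ∀ {a c} → a ∈ U → b ∈ U → c ∈ U
               → adj G a b ≡ true → adj G b c ≡ true → a ≢ c → adj G a c ≡ true

P3FreeIn : Graph n → Subset n → Set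
P3FreeIn G U = ∀ {b} → P3FreeAt G U b

P3Free⇒P3FreeIn : ∀ {G : Graph n} {U} → P3Free G → P3FreeIn G U
P3Free⇒P3FreeIn p {b} {a} {c} _ _ _ = p a b c

P3FreeIn-mono : ∀ {G : Graph n} {U V} → V ⊆ U → P3FreeIn G U → P3FreeIn G V
P3FreeIn-mono V⊆U p a∈ b∈ c∈ = p (V⊆U a∈) (V⊆U b∈) (V⊆U c∈)

connected-P3Free⇒clique : ∀ {G : Graph n} {C} → ConnectedIn G C → P3FreeIn G C → IsClique G C
connected-P3Free⇒clique {G = G} {C} C-conn p u v u∈ v∈ = adjacent (C-conn u v u∈ v∈)
  where
  adjacent : ∀ {x y} → Reach G C x y → x ≢ y → adj G x y ≡ true
  adjacent (here _) x≢x = contradiction refl x≢x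
  adjacent {y = y} (step {w = w} x∈ e r) x≢y with w ≟ y
  ... | yes refl = e
  ... | no w≢y   = p x∈ (source r) (target r) e (adjacent r w≢y) x≢y

IsClusterIn : Graph n → Subset n → Set
IsClusterIn G U = ∀ C → IsComponentIn G U C → IsClique G C

P3FreeIn⇒IsClusterIn : ∀ {G : Graph n} {U} → P3FreeIn G U → IsClusterIn G U
P3FreeIn⇒IsClusterIn {G = G} p C (C⊆U , _ , C-conn , _) =
  connected-P3Free⇒clique C-conn (P3FreeIn-mono {G = G} C⊆U p)

IsClusterIn⇒P3FreeIn : ∀ {G : Graph n} {U} → IsClusterIn G U → P3FreeIn G U
IsClusterIn⇒P3FreeIn {G = G} {U} cluster {b} {a} {c} a∈ b∈ c∈ e₁ e₂ =
  cluster (component G U a) (component-isComponent a∈) a c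
          (∈-component⁺ (here a∈)) (∈-component⁺ (step a∈ e₁ (edge b∈ c∈ e₂)))

component-adj-closed : ∀ {G : Graph n} {C x y} → IsComponent G C → x ∈ C → adj G x y ≡ true → y ∈ C
component-adj-closed (_ , _ , _ , C-closed) x∈C e = C-closed _ _ x∈C (edge ∈⊤ ∈⊤ e)

P3FreeIn-by-component : ∀ {G : Graph n} {U C} → IsComponent G C
                      → P3FreeIn G (C ∩ U) → P3FreeIn G (∁ C ∩ U) → P3FreeIn G U
P3FreeIn-by-component {G = G} {U} {C} C-comp inC offC {b} {a} {c} a∈ b∈ c∈ e₁ e₂
  with b ∈? C
... | yes b∈C = inC (x∈p∩q⁺ (a∈C , a∈)) (x∈p∩q⁺ (b∈C , b∈)) (x∈p∩q⁺ (c∈C , c∈)) e₁ e₂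
  where
  a∈C = component-adj-closed C-comp b∈C (trans (adj-sym G b a) e₁)
  c∈C = component-adj-closed C-comp b∈C e₂
... | no b∉C = offC (x∈p∩q⁺ (a∉C , a∈)) (x∈p∩q⁺ (x∉p⇒x∈∁p b∉C , b∈)) (x∈p∩q⁺ (c∉C , c∈)) e₁ e₂
  where
  a∉C = x∉p⇒x∈∁p λ a∈C → b∉C (component-adj-closed C-comp a∈C e₁)
  c∉C = x∉p⇒x∈∁p λ c∈C → b∉C (component-adj-closed C-comp c∈C (trans (adj-sym G c b) e₂))

P3FreeIn-∁-unique-nonclique : ∀ {G : Graph n} {C} → (∀ D → NonCliqueComponent G D → D ≡ C)
                            → P3FreeIn G (∁ C)
P3FreeIn-∁-unique-nonclique {G = G} {C} unique {b} {a} {c} _ b∈ _ e₁ e₂ a≢c with adj G a c ≟ᵇ true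
... | yes e = e
... | no ¬e = contradiction (subst (b ∈_) (unique Cb (Cb-comp , Cb-nonclique)) (reached (here ∈⊤)))
                            (x∈∁p⇒x∉p b∈)
  where
  Cb = component G Full b
  Cb-comp : IsComponent G Cb
  Cb-comp = component-isComponent {u = b} ∈⊤
  reached : ∀ {v} → Reach G Full b v → v ∈ Cb
  reached = ∈-component⁺
  Cb-nonclique : ¬ IsClique G Cb
  Cb-nonclique clique = ¬e (clique a c (reached (edge ∈⊤ ∈⊤ (trans (adj-sym G b a) e₁)))
                                       (reached (edge ∈⊤ ∈⊤ e₂)) a≢c)

record CCVDMap (G : Graph n) (U : Subset n) (G′ : Graph m) (U′ : Subset m) : Set where
  field
    map  : Subset n → Subset m
    ccvd : ∀ {S} → IsCCVDIn G U S → IsCCVDIn G′ U′ (map S)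
    size : ∀ {S} → IsCCVDIn G U S → ∣ map S ∣ ≡ ∣ S ∣

ςcIn≡-transport : ∀ {G : Graph n} {U} {G′ : Graph m} {U′}
                → CCVDMap G U G′ U′ → CCVDMap G′ U′ G U → ∀ {x} → ςcIn≡ G U x → ςcIn≡ G′ U′ x
ςcIn≡-transport f g {fin k} ((S , S-ccvd , ∣S∣≡k) , minimal) =
    (F.map S , F.ccvd S-ccvd , trans (F.size S-ccvd) ∣S∣≡k)
  , λ S′ S′-ccvd → subst (k ≤_) (B.size S′-ccvd) (minimal (B.map S′) (B.ccvd S′-ccvd))
  where
  module F = CCVDMap f
  module B = CCVDMap g
ςcIn≡-transport f g {∞} none S′ S′-ccvd = none (B.map S′) (B.ccvd S′-ccvd)
  where module B = CCVDMap g

ςcIn≡-cong : ∀ {G : Graph n} {U} {G′ : Graph m} {U′}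
           → CCVDMap G U G′ U′ → CCVDMap G′ U′ G U → ∀ x → ςcIn≡ G U x ⇔ ςcIn≡ G′ U′ x
ςcIn≡-cong f g x = mk⇔ (ςcIn≡-transport f g) (ςcIn≡-transport g f)

ςcIn≡0 : ∀ {G : Graph n} {U} → P3FreeIn G U → ςcIn≡ G U (fin 0)
ςcIn≡0 {n} {G} {U} p =
    (∅ , (⊥-elim ∘ ∉⊥ , P3FreeIn⇒IsClusterIn (P3FreeIn-mono {G = G} (p─q⊆p U ∅) p) , λ _ _ u∈∅ → ⊥-elim (∉⊥ u∈∅))
       , ∣⊥∣≡0 n)
  , λ _ _ → z≤n

record DisjointUnion (H : Graph N) (K : Graph m) (K′ : Graph m′) : Set where
  field
    vertex     : (Fin m ⊎ Fin m′) ↔ Fin N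
    adj-vertex : ∀ s t → adj H (Inverse.to vertex s) (Inverse.to vertex t) ≡ uadj (adj K) (adj K′) s t

  ι : Fin m → Fin N
  ι = Inverse.to vertex ∘ inj₁

  ι′ : Fin m′ → Fin N
  ι′ = Inverse.to vertex ∘ inj₂

  -- Implied by vertex; recorded so that no counting along a bijection is needed.
  field
    ∣∣-sides : ∀ T → ∣ T ∣ ≡ ∣ preimage ι T ∣ + ∣ preimage ι′ T ∣

uadj-swap : ∀ {a b} (f : Fin a → Fin a → Bool) (g : Fin b → Fin b → Bool) s t
          → uadj f g (⊎-swap s) (⊎-swap t) ≡ uadj g f s t
uadj-swap f g (inj₁ x) (inj₁ y) = refl
uadj-swap f g (inj₁ x) (inj₂ y) = refl
uadj-swap f g (inj₂ x) (inj₁ y) = refl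
uadj-swap f g (inj₂ x) (inj₂ y) = refl

swap : ∀ {H : Graph N} {K : Graph m} {K′ : Graph m′} → DisjointUnion H K K′ → DisjointUnion H K′ K
swap {K = K} {K′} D = record
  { vertex     = vertex ↔-∘ swap-↔
  ; adj-vertex = λ s t → trans (adj-vertex (⊎-swap s) (⊎-swap t)) (uadj-swap (adj K) (adj K′) s t)
  ; ∣∣-sides   = λ T → trans (∣∣-sides T) (+-comm ∣ preimage ι T ∣ ∣ preimage ι′ T ∣)
  }
  where open DisjointUnion D

⊕-disjointUnion : ∀ {n₁ n₂} (G₁ : Graph n₁) (G₂ : Graph n₂) → DisjointUnion (G₁ ⊕ G₂) G₁ G₂
⊕-disjointUnion {n₁} {n₂} G₁ G₂ = record
  { vertex     = ↔-sym +↔⊎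
  ; adj-vertex = adj-join
  ; ∣∣-sides   = ∣∣-join
  }
  where
  adj-join : ∀ s t → adj (G₁ ⊕ G₂) (join n₁ n₂ s) (join n₁ n₂ t) ≡ uadj (adj G₁) (adj G₂) s t
  adj-join s t rewrite splitAt-join n₁ n₂ s | splitAt-join n₁ n₂ t = refl

  ∣∣-join : ∀ T → ∣ T ∣ ≡ ∣ preimage (_↑ˡ n₂) T ∣ + ∣ preimage (n₁ ↑ʳ_) T ∣
  ∣∣-join T with Vec.splitAt n₁ T
  ... | p , q , refl = begin
    ∣ p ++ q ∣                                                        ≡⟨ ∣∣-++ p q ⟩
    ∣ p ∣ + ∣ q ∣                                                     ≡⟨ sym (cong₂ _+_ (cong ∣_∣ (preimage-↑ˡ p q))
                                                                                        (cong ∣_∣ (preimage-↑ʳ p q))) ⟩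
    ∣ preimage (_↑ˡ n₂) (p ++ q) ∣ + ∣ preimage (n₁ ↑ʳ_) (p ++ q) ∣  ∎
    where open ≡-Reasoning

module LeftSummand {H : Graph N} {K : Graph m} {K′ : Graph m′} (D : DisjointUnion H K K′) where

  open DisjointUnion D
  open Inverse vertex using (to; from; strictlyInverseˡ; strictlyInverseʳ)

  data Side : Fin N → Set where
    left  : ∀ a → Side (ι a)
    right : ∀ b → Side (ι′ b)

  side : ∀ x → Side x
  side x = subst Side (strictlyInverseˡ x) (side-of (from x))
    where
    side-of : ∀ s → Side (to s)
    side-of (inj₁ a) = left a
    side-of (inj₂ b) = right b

  ι-injective : ∀ {a b} → ι a ≡ ι b → a ≡ b
  ι-injective = inj₁-injective ∘ Injection.injective (↔⇒↣ vertex)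

  ι≢ι′ : ∀ {a b} → ι a ≢ ι′ b
  ι≢ι′ e with Injection.injective (↔⇒↣ vertex) e
  ... | ()

  adj-ι : ∀ a b → adj H (ι a) (ι b) ≡ adj K a b
  adj-ι a b = adj-vertex (inj₁ a) (inj₁ b)

  neighbour-ι : ∀ {a y} → adj H (ι a) y ≡ true → ∃ λ b → y ≡ ι b
  neighbour-ι {y = y} e with side y
  ... | left b  = b , refl
  ... | right b with trans (sym e) (adj-vertex (inj₁ _) (inj₂ b))
  ...   | ()

  opaque
    lift : Subset m → Subset N
    lift S = tabulate ([ lookup S , const false ]′ ∘ from)

    ∈-lift⁺ : ∀ {S a} → a ∈ S → ι a ∈ lift S
    ∈-lift⁺ {S} {a} a∈ =
      ∈-tabulate⁺ (trans (cong [ lookup S , const false ]′ (strictlyInverseʳ (inj₁ a))) ([]=⇒lookup a∈))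

    ∈-lift⁻ : ∀ {S a} → ι a ∈ lift S → a ∈ S
    ∈-lift⁻ {S} {a} ιa∈ =
      lookup⇒[]= a S (trans (sym (cong [ lookup S , const false ]′ (strictlyInverseʳ (inj₁ a)))) (∈-tabulate⁻ ιa∈))

    ι′∉lift : ∀ {S b} → ι′ b ∉ lift S
    ι′∉lift {S} {b} ι′b∈
      with trans (sym (cong [ lookup S , const false ]′ (strictlyInverseʳ (inj₂ b)))) (∈-tabulate⁻ ι′b∈)
    ... | ()

  lift⁻ : ∀ {S x} → x ∈ lift S → ∃ λ a → x ≡ ι a × a ∈ S
  lift⁻ {x = x} x∈ with side x
  ... | left a  = a , refl , ∈-lift⁻ x∈
  ... | right b = contradiction x∈ ι′∉lift

  preimage-lift : ∀ {S} → preimage ι (lift S) ≡ S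
  preimage-lift = ⊆-antisym (∈-lift⁻ ∘ ∈-preimage⁻) (∈-preimage⁺ ∘ ∈-lift⁺)

  ∣preimage-ι∣ : ∀ {T} → (∀ {b} → ι′ b ∉ T) → ∣ preimage ι T ∣ ≡ ∣ T ∣
  ∣preimage-ι∣ {T} T-left = begin
    ∣ preimage ι T ∣                       ≡⟨ sym (+-identityʳ _) ⟩
    ∣ preimage ι T ∣ + 0                   ≡⟨ cong (∣ preimage ι T ∣ +_) (sym ∣preimage-ι′∣≡0) ⟩
    ∣ preimage ι T ∣ + ∣ preimage ι′ T ∣   ≡⟨ sym (∣∣-sides T) ⟩
    ∣ T ∣                                  ∎
    where
    open ≡-Reasoning
    ∣preimage-ι′∣≡0 : ∣ preimage ι′ T ∣ ≡ 0
    ∣preimage-ι′∣≡0 = trans (cong ∣_∣ (Empty-unique λ (_ , b∈) → T-left (∈-preimage⁻ {f = ι′} b∈))) (∣⊥∣≡0 m′)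

  ∣lift∣ : ∀ {S} → ∣ lift S ∣ ≡ ∣ S ∣
  ∣lift∣ {S} = trans (sym (∣preimage-ι∣ (ι′∉lift {S}))) (cong ∣_∣ (preimage-lift {S}))

  push : ∀ {S a b} → Reach K S a b → Reach H (lift S) (ι a) (ι b)
  push (here a∈)     = here (∈-lift⁺ a∈)
  push (step a∈ e r) = step (∈-lift⁺ a∈) (trans (adj-ι _ _) e) (push r)

  pull : ∀ {T a x} → Reach H T (ι a) x → ∃ λ b → x ≡ ι b × Reach K (preimage ι T) a b
  pull (here ιa∈) = _ , refl , here (∈-preimage⁺ ιa∈)
  pull (step ιa∈ e r) with neighbour-ι e
  ... | _ , refl with pull r
  ...   | b , x≡ιb , r′ = b , x≡ιb , step (∈-preimage⁺ ιa∈) (trans (sym (adj-ι _ _)) e) r′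

  ConnectedIn-lift : ∀ {S} → ConnectedIn K S → ConnectedIn H (lift S)
  ConnectedIn-lift S-conn x y x∈ y∈ with lift⁻ x∈ | lift⁻ y∈
  ... | a , refl , a∈ | b , refl , b∈ = push (S-conn a b a∈ b∈)

  ConnectedIn-preimage : ∀ {T} → ConnectedIn H T → ConnectedIn K (preimage ι T)
  ConnectedIn-preimage T-conn a b a∈ b∈ with pull (T-conn (ι a) (ι b) (∈-preimage⁻ a∈) (∈-preimage⁻ b∈))
  ... | b′ , ιb≡ιb′ , r rewrite ι-injective ιb≡ιb′ = r

  connected-one-side : ∀ {T a} → ConnectedIn H T → ι a ∈ T → ∀ b → ι′ b ∉ T
  connected-one-side T-conn ιa∈ b ι′b∈ with pull (T-conn _ _ ιa∈ ι′b∈)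
  ... | _ , ι′b≡ιc , _ = ι≢ι′ (sym ι′b≡ιc)

  lift-closed : ∀ {C x y} → IsComponent K C → x ∈ lift C → adj H x y ≡ true → y ∈ lift C
  lift-closed C-comp x∈ e with lift⁻ x∈
  ... | a , refl , a∈ with neighbour-ι e
  ...   | b , refl = ∈-lift⁺ (component-adj-closed C-comp a∈ (trans (sym (adj-ι a b)) e))

  P3FreeIn-preimage : ∀ {U} → P3FreeIn H U → P3FreeIn K (preimage ι U)
  P3FreeIn-preimage p {b} {a} {c} a∈ b∈ c∈ e₁ e₂ a≢c =
    trans (sym (adj-ι a c))
      (p (∈-preimage⁻ a∈) (∈-preimage⁻ b∈) (∈-preimage⁻ c∈)
         (trans (adj-ι a b) e₁) (trans (adj-ι b c) e₂) (a≢c ∘ ι-injective))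

  P3FreeAt-ι : ∀ {U b} → P3FreeIn K (preimage ι U) → P3FreeAt H U (ι b)
  P3FreeAt-ι {b = b} p {x} x∈ b∈ z∈ e₁ e₂ x≢z
    with neighbour-ι (trans (adj-sym H (ι b) x) e₁) | neighbour-ι e₂
  ... | a , refl | c , refl =
    trans (adj-ι a c)
      (p (∈-preimage⁺ x∈) (∈-preimage⁺ b∈) (∈-preimage⁺ z∈)
         (trans (sym (adj-ι a b)) e₁) (trans (sym (adj-ι b c)) e₂) (x≢z ∘ cong ι))

  P3FreeIn-remainder : ∀ {T} → IsCCVDIn H Full T → P3FreeIn K (preimage ι (Full ─ T))
  P3FreeIn-remainder (_ , cluster , _) = P3FreeIn-preimage (IsClusterIn⇒P3FreeIn cluster)

  ccvd-meets-lift : ∀ {C T} → NonCliqueComponent K C → IsCCVDIn H Full T → ¬ (∀ {x} → x ∈ T → x ∉ lift C)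
  ccvd-meets-lift {C} {T} ((_ , _ , C-conn , _) , nonclique) T-ccvd T-misses =
    nonclique (connected-P3Free⇒clique C-conn (P3FreeIn-mono {G = K} C⊆ (P3FreeIn-remainder T-ccvd)))
    where
    C⊆ : C ⊆ preimage ι (Full ─ T)
    C⊆ a∈ = ∈-preimage⁺ (x∈p∧x∉q⇒x∈p─q ∈⊤ λ ιa∈T → T-misses ιa∈T (∈-lift⁺ a∈))

  ccvd-⊆-lift : ∀ {C T} → NonCliqueComponent K C → IsCCVDIn H Full T → T ⊆ lift C
  ccvd-⊆-lift {C} C-nc T-ccvd@(_ , _ , T-conn) {x} x∈T with x ∈? lift C
  ... | yes x∈ = x∈
  ... | no x∉  = ⊥-elim (ccvd-meets-lift C-nc T-ccvd λ y∈T y∈ →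
                   x∉ (Reach-closed (_∈ lift C) (lift-closed (proj₁ C-nc)) y∈ (T-conn _ x y∈T x∈T)))

  no-ccvd-two-nonclique : HasTwoNonCliqueComponents K → ∀ T → ¬ IsCCVDIn H Full T
  no-ccvd-two-nonclique (C , C′ , C-nc , C′-nc , C≢C′) T T-ccvd =
    ccvd-meets-lift C′-nc T-ccvd λ x∈T x∈C′ → C≢C′ (shared (ccvd-⊆-lift C-nc T-ccvd x∈T) x∈C′)
    where
    shared : ∀ {x} → x ∈ lift C → x ∈ lift C′ → C ≡ C′
    shared x∈C x∈C′ with lift⁻ x∈C
    ... | a , refl , a∈C = components-equal (proj₁ C-nc) (proj₁ C′-nc) a∈C (∈-lift⁻ x∈C′)

  ccvd-off-left⇒P3Free : ∀ {T} → IsCCVDIn H Full T → (∀ a → ι a ∉ T) → P3Free K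
  ccvd-off-left⇒P3Free {T} T-ccvd T-off a b c = P3FreeIn-remainder T-ccvd (kept a) (kept b) (kept c)
    where
    kept : ∀ a → a ∈ preimage ι (Full ─ T)
    kept a = ∈-preimage⁺ (x∈p∧x∉q⇒x∈p─q ∈⊤ (T-off a))

  restrict-ccvd : ∀ {C} → NonCliqueComponent K C → CCVDMap H Full K C
  restrict-ccvd {C} C-nc = record
    { map  = preimage ι
    ; ccvd = λ T-ccvd@(_ , _ , T-conn) →
          (λ a∈ → ∈-lift⁻ (ccvd-⊆-lift C-nc T-ccvd (∈-preimage⁻ a∈)))
        , P3FreeIn⇒IsClusterIn (P3FreeIn-mono {G = K} kept (P3FreeIn-remainder T-ccvd))
        , ConnectedIn-preimage T-conn
    ; size = λ T-ccvd → ∣preimage-ι∣ (ι′∉lift ∘ ccvd-⊆-lift C-nc T-ccvd)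
    }
    where
    kept : ∀ {T} → C ─ preimage ι T ⊆ preimage ι (Full ─ T)
    kept a∈ = ∈-preimage⁺ (x∈p∧x∉q⇒x∈p─q ∈⊤ (x∈p─q⇒x∉q a∈ ∘ ∈-preimage⁺))

module Summands {H : Graph N} {K : Graph m} {K′ : Graph m′} (D : DisjointUnion H K K′) where

  open DisjointUnion D using (ι; ι′)
  open LeftSummand D
  module Right = LeftSummand (swap D)

  P3FreeIn-summands : ∀ {U} → P3FreeIn K (preimage ι U) → P3FreeIn K′ (preimage ι′ U) → P3FreeIn H U
  P3FreeIn-summands p p′ {y} with side y
  ... | left _  = P3FreeAt-ι p
  ... | right _ = Right.P3FreeAt-ι p′

  no-ccvd-both-not-P3Free : ¬ P3Free K → ¬ P3Free K′ → ∀ T → ¬ IsCCVDIn H Full T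
  no-ccvd-both-not-P3Free ¬p ¬p′ T T-ccvd@(_ , _ , T-conn) with any? (λ a → ι a ∈? T)
  ... | yes (a , ιa∈T) = ¬p′ (Right.ccvd-off-left⇒P3Free T-ccvd (connected-one-side T-conn ιa∈T))
  ... | no ¬meets      = ¬p (ccvd-off-left⇒P3Free T-ccvd λ a ιa∈T → ¬meets (a , ιa∈T))

  extend-ccvd : ∀ {C} → P3Free K′ → NonCliqueComponent K C → (∀ C′ → NonCliqueComponent K C′ → C′ ≡ C)
              → CCVDMap K C H Full
  extend-ccvd {C} K′-P3Free C-nc unique = record
    { map  = lift
    ; ccvd = λ (_ , cluster , S-conn) →
          (λ _ → ∈⊤)
        , P3FreeIn⇒IsClusterIn (P3FreeIn-summands (P3FreeIn-mono {G = K} kept (P3FreeIn-off cluster))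
                                                  (P3Free⇒P3FreeIn {G = K′} K′-P3Free))
        , ConnectedIn-lift S-conn
    ; size = λ _ → ∣lift∣
    }
    where
    kept : ∀ {S} → preimage ι (Full ─ lift S) ⊆ Full ─ S
    kept a∈ = x∈p∧x∉q⇒x∈p─q ∈⊤ (x∈p─q⇒x∉q (∈-preimage⁻ a∈) ∘ ∈-lift⁺)
    inC : ∀ {S} → C ∩ (Full ─ S) ⊆ C ─ S
    inC a∈ with x∈p∩q⁻ _ _ a∈
    ... | a∈C , a∉S = x∈p∧x∉q⇒x∈p─q a∈C (x∈p─q⇒x∉q a∉S)
    P3FreeIn-off : ∀ {S} → IsClusterIn K (C ─ S) → P3FreeIn K (Full ─ S)
    P3FreeIn-off cluster =
      P3FreeIn-by-component (proj₁ C-nc)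
        (P3FreeIn-mono {G = K} inC (IsClusterIn⇒P3FreeIn cluster))
        (P3FreeIn-mono {G = K} (p∩q⊆p _ _) (P3FreeIn-∁-unique-nonclique unique))

  ςc≡-unique-nonclique : ∀ C → P3Free K′ → NonCliqueComponent K C → (∀ C′ → NonCliqueComponent K C′ → C′ ≡ C)
                       → ∀ x → ςc≡ H x ⇔ ςcIn≡ K C x
  ςc≡-unique-nonclique C K′-P3Free C-nc unique =
    ςcIn≡-cong (restrict-ccvd C-nc) (extend-ccvd K′-P3Free C-nc unique)

lemma23 : ∀ {n₁ n₂} (G₁ : Graph n₁) (G₂ : Graph n₂)
    → ((HasTwoNonCliqueComponents G₁ ⊎ HasTwoNonCliqueComponents G₂
          ⊎ (¬ P3Free G₁ × ¬ P3Free G₂))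
        → ςc≡ (G₁ ⊕ G₂) ∞)
    × (∀ (C : Subset n₁) → P3Free G₂ → NonCliqueComponent G₁ C
        → (∀ D → NonCliqueComponent G₁ D → D ≡ C)
        → ∀ x → ςc≡ (G₁ ⊕ G₂) x ⇔ ςcIn≡ G₁ C x)
    × (∀ (C : Subset n₂) → P3Free G₁ → NonCliqueComponent G₂ C
        → (∀ D → NonCliqueComponent G₂ D → D ≡ C)
        → ∀ x → ςc≡ (G₁ ⊕ G₂) x ⇔ ςcIn≡ G₂ C x)
    × (P3Free G₁ → P3Free G₂ → ςc≡ (G₁ ⊕ G₂) (fin 0))
lemma23 G₁ G₂ =
    (λ { (inj₁ two)                 → LeftSummand.no-ccvd-two-nonclique D two
       ; (inj₂ (inj₁ two))          → LeftSummand.no-ccvd-two-nonclique (swap D) two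
       ; (inj₂ (inj₂ (¬p₁ , ¬p₂))) → Summands.no-ccvd-both-not-P3Free D ¬p₁ ¬p₂ })
  , Summands.ςc≡-unique-nonclique D
  , Summands.ςc≡-unique-nonclique (swap D)
  , λ p₁ p₂ → ςcIn≡0 (Summands.P3FreeIn-summands D (P3Free⇒P3FreeIn {G = G₁} p₁) (P3Free⇒P3FreeIn {G = G₂} p₂))
  where
  D = ⊕-disjointUnion G₁ G₂
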